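{- Let $\phi$ be a 3CNF formula with variables $x_1,\ldots,x_n$ and clauses $c_1,\ldots,c_m$, each clause containing exactly three variables. The graph $G(\phi)$ constructed below has clique-width at most $8$.
   Context: Support operation: given a graph, a vertex $u$ and a set $S$ of positive integers, for each $i\in S$ add a new clique on $i$ new vertices and connect one arbitrary vertex of this clique to $u$. Construction of $G(\phi)$: (1) for each $i\in[n]$ create vertices $x_i^P,x_i^N$ and the edge $x_i^Px_i^N$; (2) support $x_i^P$ and $x_i^N$ each with the set $[2i-2]$ (empty for $i=1$); (3) for each $i\in[n],j\in[m]$ such that $x_i$ appears in $c_j$, create a vertex $x_{i,j}$; if $x_i$ appears positively in $c_j$ connect $x_{i,j}$ to $x_{i'}^P$ for all $i'\in[n]$, otherwise connect $x_{i,j}$ to $x_{i'}^N$ for all $i'\in[n]$; (4) support each such $x_{i,j}$ with the set $(\{2k: k\in[n]\}\cup\{2i-1,2n+1,2n+2\})\setminus\{2i\}$; (5) for each $j\in[m]$ create a vertex $c_j$ adjacent to the (three) vertices $x_{i,j}$ and support $c_j$ with $[2n]$; (6) for each $j\in[m]$ create a vertex $d_j$ adjacent to $c_j$ and support $d_j$ with $[2n+3]\cup[2n+5,2n+3+j]$; (7) create a vertex $u$ adjacent to all $d_j$, $j\in[m]$, and support $u$ with $[2n+4]\cup[2n+5+m,10n+10m]$. Here $[a,b]=\{k: a\le k\le b\}$ and $[a]=[1,a]$. Clique-width is the standard width measure defined via expressions using labeled vertex creation, disjoint union, joins between all vertices of two labels, and relabeling. -}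

module Defs where

open import Data.Nat using (ℕ; zero; suc; _+_; _*_; _∸_; _≤ᵇ_; _≡ᵇ_)
open import Data.Bool using (Bool; true; false; _∧_; _∨_; not; T; if_then_else_)
open import Data.Fin using (Fin; toℕ) renaming (zero to fz)
import Data.Fin as F
open import Data.Product using (Σ; _×_; _,_; proj₁; proj₂; ∃-syntax)
open import Data.Sum using (_⊎_; inj₁; inj₂)
open import Data.Unit using (⊤)
open import Data.Empty using (⊥)
open import Relation.Binary.PropositionalEquality using (_≡_; _≢_)
open import Relation.Nullary using (yes; no)
open import Function.Bundles using (_↔_; _⇔_; Inverse)

-- 3CNF formulas
-- A literal over variables x_1..x_n : variable index (Fin n, 0-based,
-- so index i stands for x_{toℕ i + 1}) and polarity (true = positive).

Lit : ℕ → Set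
Lit n = Fin n × Bool

record CNF3 (n m : ℕ) : Set where
  field
    clause   : Fin m → Fin 3 → Lit n
    distinct : ∀ j (t t' : Fin 3) →
               proj₁ (clause j t) ≡ proj₁ (clause j t') → t ≡ t'
open CNF3 public

inRange : ℕ → ℕ → ℕ → Bool
inRange a b s = (a ≤ᵇ s) ∧ (s ≤ᵇ b)

evenB : ℕ → Bool
evenB zero          = true
evenB (suc zero)    = false
evenB (suc (suc k)) = evenB k

evensUpTo : ℕ → ℕ → Bool
evensUpTo n s = evenB s ∧ inRange 2 (2 * n) s

-- "base" vertices (everything except the support cliques).
-- x_{i,j} is indexed by the clause j and the position t ∈ Fin 3 of the
-- occurrence of x_i in c_j (variables in a clause are distinct, so this
-- is in bijection with pairs (i,j) with x_i in c_j).
data Base (n m : ℕ) : Set where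
  xP xN : Fin n → Base n m
  xo    : Fin m → Fin 3 → Base n m
  c d   : Fin m → Base n m
  u     : Base n m

-- the support set of each base vertex (indices 1-based as in the paper:
-- variable index i ↦ toℕ i + 1, clause index j ↦ toℕ j + 1)
support : ∀ {n m} → CNF3 n m → Base n m → ℕ → Bool
support {n} {m} φ (xP i) s = inRange 1 (2 * toℕ i) s          -- [2i-2]
support {n} {m} φ (xN i) s = inRange 1 (2 * toℕ i) s          -- [2i-2]
support {n} {m} φ (xo j t) s =
  let i = toℕ (proj₁ (clause φ j t)) in
  (evensUpTo n s ∨ (s ≡ᵇ 2 * i + 1) ∨ (s ≡ᵇ 2 * n + 1) ∨ (s ≡ᵇ 2 * n + 2))
  ∧ not (s ≡ᵇ 2 * i + 2)                                       -- (..∪{2i-1,2n+1,2n+2})∖{2i}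
support {n} {m} φ (c j) s = inRange 1 (2 * n) s
support {n} {m} φ (d j) s =
  inRange 1 (2 * n + 3) s ∨ inRange (2 * n + 5) (2 * n + 3 + (toℕ j + 1)) s
support {n} {m} φ u s =
  inRange 1 (2 * n + 4) s ∨ inRange (2 * n + 5 + m) (10 * n + 10 * m) s

-- vertices of G(φ): base vertices, and for each base vertex b and each
-- s in its support set, a clique on s new vertices indexed by Fin s;
-- the vertex fz of that clique is the one joined to b.
data Vtx {n m : ℕ} (φ : CNF3 n m) : Set where
  base : Base n m → Vtx φ
  cl   : (b : Base n m) (s : ℕ) → T (support φ b s) → Fin s → Vtx φ

-- directed generating edges; adjacency is their symmetric closure
data Edge {n m : ℕ} (φ : CNF3 n m) : Vtx φ → Vtx φ → Set where
  eX    : ∀ i → Edge φ (base (xP i)) (base (xN i))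
  eOccP : ∀ j t i' → proj₂ (clause φ j t) ≡ true →
          Edge φ (base (xo j t)) (base (xP i'))
  eOccN : ∀ j t i' → proj₂ (clause φ j t) ≡ false →
          Edge φ (base (xo j t)) (base (xN i'))
  eC    : ∀ j t → Edge φ (base (c j)) (base (xo j t))
  eD    : ∀ j → Edge φ (base (d j)) (base (c j))
  eU    : ∀ j → Edge φ (base u) (base (d j))
  eCl   : ∀ b s p (r r' : Fin s) → r ≢ r' → Edge φ (cl b s p r) (cl b s p r')
  eAtt  : ∀ b s p → Edge φ (cl b (suc s) p fz) (base b)

Adj : ∀ {n m} (φ : CNF3 n m) → Vtx φ → Vtx φ → Set
Adj φ a b = Edge φ a b ⊎ Edge φ b a

data Expr (k : ℕ) : Set where
  vert    : Fin k → Expr k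
  _⊕_     : Expr k → Expr k → Expr k
  join    : (i j : Fin k) → i ≢ j → Expr k → Expr k
  relabel : (i j : Fin k) → Expr k → Expr k

EV : ∀ {k} → Expr k → Set
EV (vert _)          = ⊤
EV (e ⊕ f)           = EV e ⊎ EV f
EV (join _ _ _ e)    = EV e
EV (relabel _ _ e)   = EV e

label : ∀ {k} (e : Expr k) → EV e → Fin k
label (vert i)        _        = i
label (e ⊕ f)         (inj₁ v) = label e v
label (e ⊕ f)         (inj₂ v) = label f v
label (join _ _ _ e)  v        = label e v
label (relabel i j e) v with label e v F.≟ i
... | yes _ = j
... | no  _ = label e v

EAdj : ∀ {k} (e : Expr k) → EV e → EV e → Set
EAdj (vert _)         _        _        = ⊥
EAdj (e ⊕ f)          (inj₁ a) (inj₁ b) = EAdj e a b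
EAdj (e ⊕ f)          (inj₁ a) (inj₂ b) = ⊥
EAdj (e ⊕ f)          (inj₂ a) (inj₁ b) = ⊥
EAdj (e ⊕ f)          (inj₂ a) (inj₂ b) = EAdj f a b
EAdj (join i j _ e)   a        b        =
  EAdj e a b ⊎ ((label e a ≡ i × label e b ≡ j) ⊎ (label e a ≡ j × label e b ≡ i))
EAdj (relabel _ _ e)  a        b        = EAdj e a b

CwAtMost : ℕ → (V : Set) → (V → V → Set) → Set
CwAtMost k V adj =
  Σ (Expr k) λ e → Σ (V ↔ EV e) λ f →
    ∀ a b → adj a b ⇔ EAdj e (Inverse.to f a) (Inverse.to f b)

module Submission where

-- A k-expression is built bottom-up, so the proof works with *labelled
-- realisations*: a graph (V, adj) together with a labelling V → Fin k and a
-- k-expression whose graph is isomorphic to it, the isomorphism carrying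
-- the labelling to the labels the expression assigns. The module Construction assembles
-- G(φ) from such gadgets with eight labels:
--   0 finished vertices, 1 x_i^P, 2 x_i^N, 3/4 positive/negative
--   occurrence vertices x_{i,j}, 5 c_j, 6 d_j, 7 u.
-- Each variable gadget joins x_i^P (1) with x_i^N (2); each clause gadget
-- joins c_j (5) to its occurrences (3,4) and to d_j (6) and then retires
-- c_j; finally all gadgets and u are united and the joins 3–1, 4–2 and
-- 7–6 add the occurrence edges and the edges u d_j. Only the join steps
-- need a real argument in the backward direction: a join of labels i, j
-- creates exactly the intended edges because the vertices with a nonzero
-- label (the "ports" of a gadget) are known precisely.

open import Defs
open import Data.Nat using (ℕ; zero; suc; _+_; _*_; _≤_; _<_; z≤n; s≤s; _≡ᵇ_)
open import Data.Nat.Properties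
open import Data.Bool using (Bool; true; false; T; _∨_)
open import Data.Bool.Properties using (T-irrelevant; T-∧; T-∨)
open import Data.Fin using (Fin; toℕ; #_) renaming (zero to fz; suc to fs)
import Data.Fin as F
open import Data.Fin.Properties using (toℕ<n) renaming (suc-injective to fs-injective)
open import Data.Product using (Σ; _×_; _,_; proj₁; proj₂; uncurry)
open import Data.Sum using (_⊎_; inj₁; inj₂) renaming ([_,_]′ to [_,_]; map to ⊎-map)
open import Data.Unit using (⊤; tt)
open import Data.Empty using (⊥; ⊥-elim)
open import Function using (const; id; _∘′_)
open import Function.Bundles using (Equivalence; mk↔ₛ′; mk⇔)
open import Relation.Binary.PropositionalEquality hiding ([_])
open import Relation.Nullary using (yes; no)

data UnionAdj {V₁ V₂ : Set} (a₁ : V₁ → V₁ → Set) (a₂ : V₂ → V₂ → Set)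
     : V₁ ⊎ V₂ → V₁ ⊎ V₂ → Set where
  left  : ∀ {x y} → a₁ x y → UnionAdj a₁ a₂ (inj₁ x) (inj₁ y)
  right : ∀ {x y} → a₂ x y → UnionAdj a₁ a₂ (inj₂ x) (inj₂ y)

data FamilyAdj {I : Set} {V : I → Set} (a : ∀ i → V i → V i → Set)
     : Σ I V → Σ I V → Set where
  inside : ∀ {i x y} → a i x y → FamilyAdj a (i , x) (i , y)

JoinAdj : ∀ {k} {V : Set} → (V → Fin k) → Fin k → Fin k → (V → V → Set) → V → V → Set
JoinAdj lab i j a x y = a x y ⊎ ((lab x ≡ i × lab y ≡ j) ⊎ (lab x ≡ j × lab y ≡ i))

Below : (ℕ → Set) → ℕ → Set
Below V N = Σ ℕ λ s → s < N × V s

data BelowAdj {V : ℕ → Set} (a : ∀ s → V s → V s → Set) {N : ℕ}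
     : Below V N → Below V N → Set where
  inside : ∀ {s lt lt' x y} → a s x y → BelowAdj a (s , lt , x) (s , lt' , y)

belowLab : ∀ {k} {V : ℕ → Set} {N} → (∀ s → V s → Fin k) → Below V N → Fin k
belowLab lv (s , _ , x) = lv s x

module _ {V : ℕ → Set} where

  peel : ∀ {N} → Below V (suc N) → Below V N ⊎ V N
  peel {N} (s , lt , x) with s ≟ N
  ... | yes refl = inj₂ x
  ... | no  s≢N  = inj₁ (s , ≤∧≢⇒< (m<1+n⇒m≤n lt) s≢N , x)

  unpeel : ∀ {N} → Below V N ⊎ V N → Below V (suc N)
  unpeel (inj₁ (s , lt , x)) = s , m<n⇒m<1+n lt , x
  unpeel {N} (inj₂ x)        = N , n<1+n N , x

  unpeel-peel : ∀ {N} (y : Below V (suc N)) → unpeel (peel y) ≡ y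
  unpeel-peel {N} (s , lt , x) with s ≟ N
  ... | yes refl = cong (λ p → s , p , x) (<-irrelevant _ _)
  ... | no  _    = cong (λ p → s , p , x) (<-irrelevant _ _)

  peel-unpeel : ∀ {N} (y : Below V N ⊎ V N) → peel (unpeel y) ≡ y
  peel-unpeel {N} (inj₁ (s , lt , x)) with s ≟ N
  ... | yes refl = ⊥-elim (<-irrefl refl lt)
  ... | no  _    = cong (λ p → inj₁ (s , p , x)) (<-irrelevant _ _)
  peel-unpeel {N} (inj₂ x) with N ≟ N
  ... | yes refl = refl
  ... | no  N≢N  = ⊥-elim (N≢N refl)

  peel-adj : ∀ {N} (av : ∀ s → V s → V s → Set) {y y' : Below V (suc N)}
           → BelowAdj av y y' → UnionAdj (BelowAdj av) (av N) (peel y) (peel y')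
  peel-adj {N} av (inside {s} p) with s ≟ N
  ... | yes refl = right p
  ... | no  _    = left (inside p)

  unpeel-adj : ∀ {N} (av : ∀ s → V s → V s → Set) {y y' : Below V N ⊎ V N}
             → UnionAdj (BelowAdj av) (av N) y y' → BelowAdj av (unpeel y) (unpeel y')
  unpeel-adj av (left (inside p)) = inside p
  unpeel-adj av (right p)         = inside p

module _ {k : ℕ} where

  relabelled : Fin k → Fin k → Fin k → Fin k
  relabelled i j x with x F.≟ i
  ... | yes _ = j
  ... | no  _ = x

  label-relabel : ∀ i j (e : Expr k) v → label (relabel i j e) v ≡ relabelled i j (label e v)
  label-relabel i j e v with label e v F.≟ i
  ... | yes _ = refl
  ... | no  _ = refl

  relabelled-hit : ∀ i j → relabelled i j i ≡ j
  relabelled-hit i j with i F.≟ i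
  ... | yes _ = refl
  ... | no i≢i = ⊥-elim (i≢i refl)

  relabelled-miss : ∀ {i j x} → x ≢ i → relabelled i j x ≡ x
  relabelled-miss {i} {j} {x} x≢i with x F.≟ i
  ... | yes x≡i = ⊥-elim (x≢i x≡i)
  ... | no  _   = refl

  record Realisation (V : Set) (lab : V → Fin k) (adj : V → V → Set) : Set where
    field
      expr     : Expr k
      to       : V → EV expr
      from     : EV expr → V
      from-to  : ∀ v → from (to v) ≡ v
      to-from  : ∀ x → to (from x) ≡ x
      label-to : ∀ v → label expr (to v) ≡ lab v
      adj⇒     : ∀ x y → adj x y → EAdj expr (to x) (to y)
      ⇒adj     : ∀ z w → EAdj expr z w → adj (from z) (from w)

    label-from : ∀ z → lab (from z) ≡ label expr z
    label-from z = trans (sym (label-to (from z))) (cong (label expr) (to-from z))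

  open Realisation

  realisation⇒cw : ∀ {V lab adj} → Realisation V lab adj → CwAtMost k V adj
  realisation⇒cw {adj = adj} R =
    expr R , mk↔ₛ′ (to R) (from R) (to-from R) (from-to R) ,
    λ x y → mk⇔ (adj⇒ R x y) (λ p → subst₂ adj (from-to R x) (from-to R y) (⇒adj R _ _ p))

  transport : ∀ {V W lab lab' adj adj'} (t : W → V) (f : V → W)
            → (∀ w → f (t w) ≡ w) → (∀ v → t (f v) ≡ v)
            → (∀ w → lab (t w) ≡ lab' w)
            → (∀ x y → adj' x y → adj (t x) (t y))
            → (∀ x y → adj x y → adj' (f x) (f y))
            → Realisation V lab adj → Realisation W lab' adj'
  transport t f ft tf lab≡ fw bw R = record
    { expr = expr R ; to = λ w → to R (t w) ; from = λ z → f (from R z)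
    ; from-to  = λ w → trans (cong f (from-to R (t w))) (ft w)
    ; to-from  = λ z → trans (cong (to R) (tf (from R z))) (to-from R z)
    ; label-to = λ w → trans (label-to R (t w)) (lab≡ w)
    ; adj⇒     = λ x y p → adj⇒ R (t x) (t y) (fw x y p)
    ; ⇒adj     = λ z w p → bw (from R z) (from R w) (⇒adj R z w p) }

  adjust : ∀ {V lab lab' adj adj'} → (∀ v → lab v ≡ lab' v)
         → (∀ x y → adj' x y → adj x y) → (∀ x y → adj x y → adj' x y)
         → Realisation V lab adj → Realisation V lab' adj'
  adjust = transport id id (λ _ → refl) (λ _ → refl)

  vertex : (i : Fin k) → Realisation ⊤ (const i) (λ _ _ → ⊥)
  vertex i = record
    { expr = vert i ; to = id ; from = id ; from-to = λ _ → refl ; to-from = λ _ → refl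
    ; label-to = λ _ → refl ; adj⇒ = λ _ _ () ; ⇒adj = λ _ _ () }

  union : ∀ {V₁ V₂ l₁ l₂ a₁ a₂} → Realisation V₁ l₁ a₁ → Realisation V₂ l₂ a₂
        → Realisation (V₁ ⊎ V₂) [ l₁ , l₂ ] (UnionAdj a₁ a₂)
  union {V₁} {V₂} {l₁} {l₂} {a₁} {a₂} R S = record
    { expr = expr R ⊕ expr S
    ; to = ⊎-map (to R) (to S) ; from = ⊎-map (from R) (from S)
    ; from-to = ft ; to-from = tf ; label-to = lt ; adj⇒ = fw ; ⇒adj = bw }
    where
    ft : ∀ v → ⊎-map (from R) (from S) (⊎-map (to R) (to S) v) ≡ v
    ft (inj₁ x) = cong inj₁ (from-to R x)
    ft (inj₂ x) = cong inj₂ (from-to S x)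
    tf : ∀ z → ⊎-map (to R) (to S) (⊎-map (from R) (from S) z) ≡ z
    tf (inj₁ x) = cong inj₁ (to-from R x)
    tf (inj₂ x) = cong inj₂ (to-from S x)
    lt : ∀ v → label (expr R ⊕ expr S) (⊎-map (to R) (to S) v) ≡ [ l₁ , l₂ ] v
    lt (inj₁ x) = label-to R x
    lt (inj₂ x) = label-to S x
    fw : ∀ x y → UnionAdj a₁ a₂ x y
       → EAdj (expr R ⊕ expr S) (⊎-map (to R) (to S) x) (⊎-map (to R) (to S) y)
    fw _ _ (left p)  = adj⇒ R _ _ p
    fw _ _ (right p) = adj⇒ S _ _ p
    bw : ∀ z w → EAdj (expr R ⊕ expr S) z w
       → UnionAdj a₁ a₂ (⊎-map (from R) (from S) z) (⊎-map (from R) (from S) w)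
    bw (inj₁ z) (inj₁ w) p = left (⇒adj R z w p)
    bw (inj₂ z) (inj₂ w) p = right (⇒adj S z w p)

  join' : ∀ {V lab a} (i j : Fin k) → i ≢ j → Realisation V lab a
        → Realisation V lab (JoinAdj lab i j a)
  join' {V} {lab} {a} i j i≢j R = record
    { expr = join i j i≢j (expr R) ; to = to R ; from = from R
    ; from-to = from-to R ; to-from = to-from R ; label-to = label-to R
    ; adj⇒ = fw ; ⇒adj = bw }
    where
    fw : ∀ x y → JoinAdj lab i j a x y → EAdj (join i j i≢j (expr R)) (to R x) (to R y)
    fw x y (inj₁ p)              = inj₁ (adj⇒ R x y p)
    fw x y (inj₂ (inj₁ (p , q))) = inj₂ (inj₁ (trans (label-to R x) p , trans (label-to R y) q))
    fw x y (inj₂ (inj₂ (p , q))) = inj₂ (inj₂ (trans (label-to R x) p , trans (label-to R y) q))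
    bw : ∀ z w → EAdj (join i j i≢j (expr R)) z w → JoinAdj lab i j a (from R z) (from R w)
    bw z w (inj₁ p)              = inj₁ (⇒adj R z w p)
    bw z w (inj₂ (inj₁ (p , q))) = inj₂ (inj₁ (trans (label-from R z) p , trans (label-from R w) q))
    bw z w (inj₂ (inj₂ (p , q))) = inj₂ (inj₂ (trans (label-from R z) p , trans (label-from R w) q))

  relabel' : ∀ {V lab a} (i j : Fin k) → Realisation V lab a
           → Realisation V (relabelled i j ∘′ lab) a
  relabel' i j R = record
    { expr = relabel i j (expr R) ; to = to R ; from = from R
    ; from-to = from-to R ; to-from = to-from R
    ; label-to = λ v → trans (label-relabel i j (expr R) (to R v)) (cong (relabelled i j) (label-to R v))
    ; adj⇒ = adj⇒ R ; ⇒adj = ⇒adj R }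

  MaybeRealised : (V : Set) → (V → Fin k) → (V → V → Set) → Set
  MaybeRealised V lab a = (V → ⊥) ⊎ Realisation V lab a

  -- Union with a possibly empty graph; the empty case needs no expression.
  unionMaybe : ∀ {V W lab lab' a a'} → Realisation V lab a → MaybeRealised W lab' a'
             → Realisation (V ⊎ W) [ lab , lab' ] (UnionAdj a a')
  unionMaybe R (inj₂ S) = union R S
  unionMaybe {V} {W} {lab} {lab'} {a} {a'} R (inj₁ empty) =
    transport t inj₁ ft (λ _ → refl) lt fw (λ _ _ → left) R
    where
    t : V ⊎ W → V
    t (inj₁ v) = v
    t (inj₂ w) = ⊥-elim (empty w)
    ft : ∀ x → inj₁ (t x) ≡ x
    ft (inj₁ v) = refl
    ft (inj₂ w) = ⊥-elim (empty w)
    lt : ∀ x → lab (t x) ≡ [ lab , lab' ] x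
    lt (inj₁ v) = refl
    lt (inj₂ w) = ⊥-elim (empty w)
    fw : ∀ x y → UnionAdj a a' x y → a (t x) (t y)
    fw _ _ (left p)          = p
    fw _ _ (right {x = w} _) = ⊥-elim (empty w)

  unionFin : ∀ {W lw aw} n {V : Fin n → Set}
             {lv : ∀ i → V i → Fin k} {av : ∀ i → V i → V i → Set}
           → Realisation W lw aw → (∀ i → Realisation (V i) (lv i) (av i))
           → Realisation (W ⊎ Σ (Fin n) V) [ lw , uncurry lv ] (UnionAdj aw (FamilyAdj av))
  unionFin zero R Rs = unionMaybe R (inj₁ λ { (() , _) })
  unionFin {W} {lw} {aw} (suc n) {V} {lv} {av} R Rs =
    transport t f ft tf lt fw bw (unionFin n (union R (Rs fz)) (λ i → Rs (fs i)))
    where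
    t : W ⊎ Σ (Fin (suc n)) V → (W ⊎ V fz) ⊎ Σ (Fin n) (V ∘′ fs)
    t (inj₁ w)          = inj₁ (inj₁ w)
    t (inj₂ (fz , x))   = inj₁ (inj₂ x)
    t (inj₂ (fs i , x)) = inj₂ (i , x)
    f : (W ⊎ V fz) ⊎ Σ (Fin n) (V ∘′ fs) → W ⊎ Σ (Fin (suc n)) V
    f (inj₁ (inj₁ w)) = inj₁ w
    f (inj₁ (inj₂ x)) = inj₂ (fz , x)
    f (inj₂ (i , x))  = inj₂ (fs i , x)
    ft : ∀ x → f (t x) ≡ x
    ft (inj₁ w)          = refl
    ft (inj₂ (fz , x))   = refl
    ft (inj₂ (fs i , x)) = refl
    tf : ∀ x → t (f x) ≡ x
    tf (inj₁ (inj₁ w)) = refl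
    tf (inj₁ (inj₂ x)) = refl
    tf (inj₂ (i , x))  = refl
    lt : ∀ x → [ [ lw , lv fz ] , uncurry (λ i → lv (fs i)) ] (t x) ≡ [ lw , uncurry lv ] x
    lt (inj₁ w)          = refl
    lt (inj₂ (fz , x))   = refl
    lt (inj₂ (fs i , x)) = refl
    fw : ∀ x y → UnionAdj aw (FamilyAdj av) x y
       → UnionAdj (UnionAdj aw (av fz)) (FamilyAdj (λ i → av (fs i))) (t x) (t y)
    fw _ _ (left p)                  = left (left p)
    fw _ _ (right (inside {fz} p))   = left (right p)
    fw _ _ (right (inside {fs i} p)) = right (inside p)
    bw : ∀ x y → UnionAdj (UnionAdj aw (av fz)) (FamilyAdj (λ i → av (fs i))) x y
       → UnionAdj aw (FamilyAdj av) (f x) (f y)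
    bw _ _ (left (left p))    = left p
    bw _ _ (left (right p))   = right (inside p)
    bw _ _ (right (inside p)) = right (inside p)

  peel-label : ∀ {V : ℕ → Set} {N} (lv : ∀ s → V s → Fin k) (y : Below V (suc N))
             → [ belowLab lv , lv N ] (peel y) ≡ belowLab lv y
  peel-label {N = N} lv (s , lt , x) with s ≟ N
  ... | yes refl = refl
  ... | no  _    = refl

  unionBelow : ∀ {W lw aw} {V : ℕ → Set}
               {lv : ∀ s → V s → Fin k} {av : ∀ s → V s → V s → Set}
             → Realisation W lw aw → (∀ s → MaybeRealised (V s) (lv s) (av s)) → ∀ N
             → Realisation (W ⊎ Below V N) [ lw , belowLab lv ] (UnionAdj aw (BelowAdj av))
  unionBelow R Rs zero = unionMaybe R (inj₁ λ { (_ , () , _) })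
  unionBelow {W} {lw} {aw} {V} {lv} {av} R Rs (suc N) =
    transport t f ft tf lt fw bw (unionMaybe (unionBelow R Rs N) (Rs N))
    where
    split : Below V N ⊎ V N → (W ⊎ Below V N) ⊎ V N
    split (inj₁ y) = inj₁ (inj₂ y)
    split (inj₂ x) = inj₂ x
    t : W ⊎ Below V (suc N) → (W ⊎ Below V N) ⊎ V N
    t (inj₁ w) = inj₁ (inj₁ w)
    t (inj₂ y) = split (peel y)
    f : (W ⊎ Below V N) ⊎ V N → W ⊎ Below V (suc N)
    f (inj₁ (inj₁ w)) = inj₁ w
    f (inj₁ (inj₂ y)) = inj₂ (unpeel (inj₁ y))
    f (inj₂ x)        = inj₂ (unpeel (inj₂ x))
    f-split : ∀ y → f (split y) ≡ inj₂ (unpeel y)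
    f-split (inj₁ y) = refl
    f-split (inj₂ x) = refl
    ft : ∀ x → f (t x) ≡ x
    ft (inj₁ w) = refl
    ft (inj₂ y) = trans (f-split (peel y)) (cong inj₂ (unpeel-peel y))
    tf : ∀ x → t (f x) ≡ x
    tf (inj₁ (inj₁ w)) = refl
    tf (inj₁ (inj₂ y)) = cong split (peel-unpeel (inj₁ y))
    tf (inj₂ x)        = cong split (peel-unpeel (inj₂ x))
    label-split : ∀ y → [ [ lw , belowLab lv ] , lv N ] (split y) ≡ [ belowLab lv , lv N ] y
    label-split (inj₁ y) = refl
    label-split (inj₂ x) = refl
    lt : ∀ x → [ [ lw , belowLab lv ] , lv N ] (t x) ≡ [ lw , belowLab lv ] x
    lt (inj₁ w) = refl
    lt (inj₂ y) = trans (label-split (peel y)) (peel-label lv y)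
    adj-split : ∀ {y y'} → UnionAdj (BelowAdj av) (av N) y y'
              → UnionAdj (UnionAdj aw (BelowAdj av)) (av N) (split y) (split y')
    adj-split (left p)  = left (right p)
    adj-split (right p) = right p
    fw : ∀ x y → UnionAdj aw (BelowAdj av) x y
       → UnionAdj (UnionAdj aw (BelowAdj av)) (av N) (t x) (t y)
    fw _ _ (left p)  = left (left p)
    fw _ _ (right p) = adj-split (peel-adj av p)
    bw : ∀ x y → UnionAdj (UnionAdj aw (BelowAdj av)) (av N) x y
       → UnionAdj aw (BelowAdj av) (f x) (f y)
    bw _ _ (left (left p))  = left p
    bw _ _ (left (right p)) = right (unpeel-adj av (left p))
    bw _ _ (right p)        = right (unpeel-adj av (right p))

  pointed : ∀ {s} → Fin k → Fin k → Fin s → Fin k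
  pointed p q fz     = p
  pointed p q (fs _) = q

  singleton : (i : Fin k) → Realisation (Fin 1) (const i) _≢_
  singleton i =
    transport (const tt) (const fz) single (λ _ → refl) (λ _ → refl) loopless (λ _ _ ()) (vertex i)
    where
    single : ∀ (r : Fin 1) → fz ≡ r
    single fz = refl
    loopless : ∀ (r r' : Fin 1) → r ≢ r' → ⊥
    loopless fz fz r≢r = r≢r refl

  cone : (i j : Fin k) → i ≢ j → ∀ {s} → Realisation (Fin (suc s)) (const j) _≢_
       → Realisation (Fin (suc (suc s))) (pointed i j) _≢_
  cone i j i≢j {s} Q = transport t f ft tf lt fw bw (join' i j i≢j (union (vertex i) Q))
    where
    t : Fin (suc (suc s)) → ⊤ ⊎ Fin (suc s)
    t fz     = inj₁ tt
    t (fs r) = inj₂ r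
    f : ⊤ ⊎ Fin (suc s) → Fin (suc (suc s))
    f (inj₁ _) = fz
    f (inj₂ r) = fs r
    ft : ∀ r → f (t r) ≡ r
    ft fz     = refl
    ft (fs r) = refl
    tf : ∀ x → t (f x) ≡ x
    tf (inj₁ tt) = refl
    tf (inj₂ r)  = refl
    lab : ⊤ ⊎ Fin (suc s) → Fin k
    lab = [ const i , const j ]
    lt : ∀ r → lab (t r) ≡ pointed i j r
    lt fz     = refl
    lt (fs r) = refl
    fw : ∀ x y → x ≢ y → JoinAdj lab i j (UnionAdj (λ _ _ → ⊥) _≢_) (t x) (t y)
    fw fz     fz     x≢y = ⊥-elim (x≢y refl)
    fw fz     (fs y) _   = inj₂ (inj₁ (refl , refl))
    fw (fs x) fz     _   = inj₂ (inj₂ (refl , refl))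
    fw (fs x) (fs y) x≢y = inj₁ (right (λ x≡y → x≢y (cong fs x≡y)))
    bw : ∀ x y → JoinAdj lab i j (UnionAdj (λ _ _ → ⊥) _≢_) x y → f x ≢ f y
    bw _        _        (inj₁ (right x≢y))        = λ eq → x≢y (fs-injective eq)
    bw (inj₁ _) (inj₁ _) (inj₂ (inj₁ (_ , i≡j)))   = ⊥-elim (i≢j i≡j)
    bw (inj₁ _) (inj₂ _) (inj₂ (inj₁ _))           = λ ()
    bw (inj₂ _) _        (inj₂ (inj₁ (j≡i , _)))   = ⊥-elim (i≢j (sym j≡i))
    bw (inj₁ _) _        (inj₂ (inj₂ (i≡j , _)))   = ⊥-elim (i≢j i≡j)
    bw (inj₂ _) (inj₁ _) (inj₂ (inj₂ _))           = λ ()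
    bw (inj₂ _) (inj₂ _) (inj₂ (inj₂ (_ , j≡i)))   = ⊥-elim (i≢j (sym j≡i))

  -- K_{s+1} with all vertices labelled a, using b as a scratch label:
  -- add a vertex labelled b, join b–a, rename b to a.
  clique : (a b : Fin k) → b ≢ a → ∀ s → Realisation (Fin (suc s)) (const a) _≢_
  clique a b b≢a zero    = singleton a
  clique a b b≢a (suc s) =
    adjust lab (λ _ _ → id) (λ _ _ → id) (relabel' b a (cone b a b≢a (clique a b b≢a s)))
    where
    lab : ∀ r → relabelled b a (pointed b a r) ≡ a
    lab fz     = relabelled-hit b a
    lab (fs r) = relabelled-miss (λ a≡b → b≢a (sym a≡b))

  pointedClique : (p q a b : Fin k) → p ≢ a → b ≢ a → ∀ s
                → Realisation (Fin (suc s)) (pointed p q) _≢_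
  pointedClique p q a b p≢a b≢a zero =
    adjust (λ { fz → refl }) (λ _ _ → id) (λ _ _ → id) (singleton p)
  pointedClique p q a b p≢a b≢a (suc s) =
    adjust lab (λ _ _ → id) (λ _ _ → id) (relabel' a q (cone p a p≢a (clique a b b≢a s)))
    where
    lab : ∀ r → relabelled a q (pointed p a r) ≡ pointed p q r
    lab fz     = relabelled-miss p≢a
    lab (fs r) = relabelled-hit a q

-- A vertex (the centre) together with, for every size s in S, a clique on s
-- new vertices one of which is joined to the centre: the support operation.
Supported : (ℕ → Bool) → Set
Supported S = ⊤ ⊎ Σ ℕ λ s → T (S s) × Fin s

data SupportAdj (S : ℕ → Bool) : Supported S → Supported S → Set where
  attach   : ∀ s p → SupportAdj S (inj₁ tt) (inj₂ (suc s , p , fz))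
  attach'  : ∀ s p → SupportAdj S (inj₂ (suc s , p , fz)) (inj₁ tt)
  inClique : ∀ s p r r' → r ≢ r' → SupportAdj S (inj₂ (s , p , r)) (inj₂ (s , p , r'))

centreLab : ∀ {S} → Fin 8 → Supported S → Fin 8
centreLab L = [ const L , const (# 0) ]

data CentrePort {S : ℕ → Bool} (L : Fin 8) : Supported S → Fin 8 → Set where
  isCentre : CentrePort L (inj₁ tt) L

centrePort : ∀ {S L} (x : Supported S) {ℓ} → centreLab L x ≡ ℓ → ℓ ≢ # 0 → CentrePort L x ℓ
centrePort (inj₁ tt) refl _   = isCentre
centrePort (inj₂ _)  refl ℓ≢0 = ⊥-elim (ℓ≢0 refl)

-- The cliques of a support set whose sizes are below N are realised with
-- labels 0–4 only: each clique is a pointed clique with point label 3, the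
-- centre is added with label 4, joined 4–3, and 3, 4 are renamed to 0, L.
module _ (S : ℕ → Bool) (N : ℕ) (bounded : ∀ s → T (S s) → s < N) where

  private
    Member : ℕ → Set
    Member s = T (S s) × Fin s

    memberLab : ∀ s → Member s → Fin 8
    memberLab s (_ , r) = pointed (# 3) (# 0) r

    memberAdj : ∀ s → Member s → Member s → Set
    memberAdj s (_ , r) (_ , r') = r ≢ r'

    member : ∀ b s → MaybeRealised {8} (T b × Fin s) (λ x → pointed (# 3) (# 0) (proj₂ x))
                                                   (λ x y → proj₂ x ≢ proj₂ y)
    member false s       = inj₁ λ { (() , _) }
    member true  zero    = inj₁ λ { (_ , ()) }
    member true  (suc s) = inj₂ (transport proj₂ (tt ,_) (λ _ → refl) (λ _ → refl) (λ _ → refl)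
                                   (λ _ _ → id) (λ _ _ → id)
                                   (pointedClique (# 3) (# 0) (# 1) (# 2) (λ ()) (λ ()) s))

    Built : Set
    Built = ⊤ ⊎ Below Member N

    builtLab : Built → Fin 8
    builtLab = [ const (# 4) , belowLab memberLab ]

    BuiltAdj : Built → Built → Set
    BuiltAdj = UnionAdj (λ _ _ → ⊥) (BelowAdj memberAdj)

    built : Realisation Built builtLab BuiltAdj
    built = unionBelow (vertex (# 4)) (λ s → member (S s) s) N

    data Port : Built → Fin 8 → Set where
      centre : Port (inj₁ tt) (# 4)
      point  : ∀ s lt p → Port (inj₂ (suc s , lt , p , fz)) (# 3)

    port : ∀ z {ℓ} → builtLab z ≡ ℓ → ℓ ≢ # 0 → Port z ℓ
    port (inj₁ tt)                      refl _   = centre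
    port (inj₂ (suc s , lt , p , fz))   refl _   = point s lt p
    port (inj₂ (suc s , lt , p , fs r)) refl ℓ≢0 = ⊥-elim (ℓ≢0 refl)

    toBuilt : Supported S → Built
    toBuilt (inj₁ tt)          = inj₁ tt
    toBuilt (inj₂ (s , p , r)) = inj₂ (s , bounded s p , p , r)

    fromBuilt : Built → Supported S
    fromBuilt (inj₁ tt)               = inj₁ tt
    fromBuilt (inj₂ (s , _ , p , r)) = inj₂ (s , p , r)

    fromBuilt-toBuilt : ∀ x → fromBuilt (toBuilt x) ≡ x
    fromBuilt-toBuilt (inj₁ tt) = refl
    fromBuilt-toBuilt (inj₂ _)  = refl

    toBuilt-fromBuilt : ∀ x → toBuilt (fromBuilt x) ≡ x
    toBuilt-fromBuilt (inj₁ tt)                = refl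
    toBuilt-fromBuilt (inj₂ (s , lt , p , r)) = cong (λ lt' → inj₂ (s , lt' , p , r)) (<-irrelevant _ _)

    Joined : Built → Built → Set
    Joined = JoinAdj builtLab (# 4) (# 3) BuiltAdj

    support⇒joined : ∀ x y → SupportAdj S x y → Joined (toBuilt x) (toBuilt y)
    support⇒joined _ _ (attach s p)             = inj₂ (inj₁ (refl , refl))
    support⇒joined _ _ (attach' s p)            = inj₂ (inj₂ (refl , refl))
    support⇒joined _ _ (inClique s p r r' r≢r') = inj₁ (right (inside r≢r'))

    joined⇒support : ∀ x y → Joined x y → SupportAdj S (fromBuilt x) (fromBuilt y)
    joined⇒support _ _ (inj₁ (right (inside {s} {x = p , r} {y = p' , r'} r≢r'))) =
      subst (λ q → SupportAdj S (inj₂ (s , p , r)) (inj₂ (s , q , r'))) (T-irrelevant p p')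
            (inClique s p r r' r≢r')
    joined⇒support x y (inj₂ (inj₁ (x4 , y3))) with port x x4 (λ ()) | port y y3 (λ ())
    ... | centre | point s _ p = attach s p
    joined⇒support x y (inj₂ (inj₂ (x3 , y4))) with port x x3 (λ ()) | port y y4 (λ ())
    ... | point s _ p | centre = attach' s p

    final-labels : ∀ L x → relabelled (# 4) L (relabelled (# 3) (# 0) (builtLab (toBuilt x)))
                         ≡ centreLab L x
    final-labels L (inj₁ tt)             = refl
    final-labels L (inj₂ (s , p , fz))   = refl
    final-labels L (inj₂ (s , p , fs r)) = refl

  supported : (L : Fin 8) → Realisation (Supported S) (centreLab L) (SupportAdj S)
  supported L =
    transport toBuilt fromBuilt fromBuilt-toBuilt toBuilt-fromBuilt (final-labels L)
              support⇒joined joined⇒support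
              (relabel' (# 4) L (relabel' (# 3) (# 0) (join' (# 4) (# 3) (λ ()) built)))

inRange-≤ : ∀ a b s → T (inRange a b s) → s ≤ b
inRange-≤ a b s p = ≤ᵇ⇒≤ s b (proj₂ (Equivalence.to T-∧ p))

module Construction {n m : ℕ} (φ : CNF3 n m) where

  bound : ℕ
  bound = (2 * n + 4 + m) + (10 * n + 10 * m)

  near-2n : ∀ {s} r → r ≤ 4 → s ≤ 2 * n + r → s < suc bound
  near-2n r r≤4 s≤ =
    s≤s (≤-trans s≤ (≤-trans (+-monoʳ-≤ (2 * n) r≤4) (≤-trans (m≤m+n _ m) (m≤m+n _ _))))

  up-to-2n : ∀ {s} → s ≤ 2 * n → s < suc bound
  up-to-2n s≤ = near-2n 0 z≤n (≤-trans s≤ (m≤m+n _ 0))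

  twice-index : ∀ (i : Fin n) → 2 * toℕ i ≤ 2 * n
  twice-index i = *-monoʳ-≤ 2 (<⇒≤ (toℕ<n i))

  occurrence-bounded : ∀ (i : Fin n) s
    → T (evensUpTo n s) ⊎ T (s ≡ᵇ 2 * toℕ i + 1) ⊎ T (s ≡ᵇ 2 * n + 1) ⊎ T (s ≡ᵇ 2 * n + 2)
    → s < suc bound
  occurrence-bounded i s (inj₁ p) =
    up-to-2n (inRange-≤ 2 (2 * n) s (proj₂ (Equivalence.to (T-∧ {evenB s}) p)))
  occurrence-bounded i s (inj₂ (inj₁ p)) rewrite ≡ᵇ⇒≡ s _ p =
    near-2n 1 (s≤s z≤n) (+-monoˡ-≤ 1 (twice-index i))
  occurrence-bounded i s (inj₂ (inj₂ (inj₁ p))) rewrite ≡ᵇ⇒≡ s _ p =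
    near-2n 1 (s≤s z≤n) ≤-refl
  occurrence-bounded i s (inj₂ (inj₂ (inj₂ p))) rewrite ≡ᵇ⇒≡ s _ p =
    near-2n 2 (s≤s (s≤s z≤n)) ≤-refl

  support-bounded : ∀ b s → T (support φ b s) → s < suc bound
  support-bounded (xP i) s p = up-to-2n (≤-trans (inRange-≤ 1 _ s p) (twice-index i))
  support-bounded (xN i) s p = up-to-2n (≤-trans (inRange-≤ 1 _ s p) (twice-index i))
  support-bounded (xo j t) s p =
    occurrence-bounded (proj₁ (clause φ j t)) s (split-∨ (proj₁ (Equivalence.to T-∧ p)))
    where
    split-∨ : ∀ {w x y z} → T (w ∨ x ∨ y ∨ z) → T w ⊎ T x ⊎ T y ⊎ T z
    split-∨ q = ⊎-map id (λ r → ⊎-map id (Equivalence.to T-∨) (Equivalence.to T-∨ r))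
                       (Equivalence.to T-∨ q)
  support-bounded (c j) s p = up-to-2n (inRange-≤ 1 _ s p)
  support-bounded (d j) s p with Equivalence.to T-∨ p
  ... | inj₁ q = near-2n 3 (s≤s (s≤s (s≤s z≤n))) (inRange-≤ 1 _ s q)
  ... | inj₂ q = s≤s (≤-trans (inRange-≤ (2 * n + 5) _ s q) (≤-trans j-bound (m≤m+n _ _)))
    where
    j-bound : 2 * n + 3 + (toℕ j + 1) ≤ 2 * n + 4 + m
    j-bound = ≤-trans (+-monoʳ-≤ (2 * n + 3) (subst (_≤ m) (+-comm 1 (toℕ j)) (toℕ<n j)))
                      (+-monoˡ-≤ m (+-monoʳ-≤ (2 * n) (s≤s (s≤s (s≤s z≤n)))))
  support-bounded u s p with Equivalence.to T-∨ p
  ... | inj₁ q = near-2n 4 ≤-refl (inRange-≤ 1 _ s q)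
  ... | inj₂ q = s≤s (≤-trans (inRange-≤ (2 * n + 5 + m) _ s q) (m≤n+m _ (2 * n + 4 + m)))

  Gadget : Base n m → Set
  Gadget b = Supported (support φ b)

  gadget : ∀ b L → Realisation (Gadget b) (centreLab L) (SupportAdj (support φ b))
  gadget b = supported (support φ b) (suc bound) (support-bounded b)

  VarV : Fin n → Set
  VarV i = Gadget (xP i) ⊎ Gadget (xN i)

  data VarAdj (i : Fin n) : VarV i → VarV i → Set where
    inP : ∀ {x y} → SupportAdj _ x y → VarAdj i (inj₁ x) (inj₁ y)
    inN : ∀ {x y} → SupportAdj _ x y → VarAdj i (inj₂ x) (inj₂ y)
    P–N : VarAdj i (inj₁ (inj₁ tt)) (inj₂ (inj₁ tt))
    N–P : VarAdj i (inj₂ (inj₁ tt)) (inj₁ (inj₁ tt))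

  varLab : ∀ i → VarV i → Fin 8
  varLab i = [ centreLab (# 1) , centreLab (# 2) ]

  data VarPort (i : Fin n) : VarV i → Fin 8 → Set where
    pos : VarPort i (inj₁ (inj₁ tt)) (# 1)
    neg : VarPort i (inj₂ (inj₁ tt)) (# 2)

  varPort : ∀ i z {ℓ} → varLab i z ≡ ℓ → ℓ ≢ # 0 → VarPort i z ℓ
  varPort i (inj₁ x) e ℓ≢0 with centrePort x e ℓ≢0
  ... | isCentre = pos
  varPort i (inj₂ x) e ℓ≢0 with centrePort x e ℓ≢0
  ... | isCentre = neg

  variable-gadget : ∀ i → Realisation (VarV i) (varLab i) (VarAdj i)
  variable-gadget i = adjust (λ _ → refl) fw bw
    (join' (# 1) (# 2) (λ ()) (union (gadget (xP i) (# 1)) (gadget (xN i) (# 2))))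
    where
    joined : VarV i → VarV i → Set
    joined = JoinAdj (varLab i) (# 1) (# 2) (UnionAdj (SupportAdj _) (SupportAdj _))
    fw : ∀ x y → VarAdj i x y → joined x y
    fw _ _ (inP p) = inj₁ (left p)
    fw _ _ (inN p) = inj₁ (right p)
    fw _ _ P–N     = inj₂ (inj₁ (refl , refl))
    fw _ _ N–P     = inj₂ (inj₂ (refl , refl))
    bw : ∀ x y → joined x y → VarAdj i x y
    bw _ _ (inj₁ (left p))  = inP p
    bw _ _ (inj₁ (right p)) = inN p
    bw x y (inj₂ (inj₁ (x1 , y2))) with varPort i x x1 (λ ()) | varPort i y y2 (λ ())
    ... | pos | neg = P–N
    bw x y (inj₂ (inj₂ (x2 , y1))) with varPort i x x2 (λ ()) | varPort i y y1 (λ ())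
    ... | neg | pos = N–P

  polarity : Fin m → Fin 3 → Bool
  polarity j t = proj₂ (clause φ j t)

  polarityLab : Bool → Fin 8
  polarityLab true  = # 3
  polarityLab false = # 4

  polarityLab-3or4 : ∀ b → polarityLab b ≡ # 3 ⊎ polarityLab b ≡ # 4
  polarityLab-3or4 true  = inj₁ refl
  polarityLab-3or4 false = inj₂ refl

  ClauseV : Fin m → Set
  ClauseV j = (Gadget (c j) ⊎ Gadget (d j)) ⊎ Σ (Fin 3) (λ t → Gadget (xo j t))

  data ClauseAdj (j : Fin m) : ClauseV j → ClauseV j → Set where
    inC   : ∀ {x y} → SupportAdj _ x y → ClauseAdj j (inj₁ (inj₁ x)) (inj₁ (inj₁ y))
    inD   : ∀ {x y} → SupportAdj _ x y → ClauseAdj j (inj₁ (inj₂ x)) (inj₁ (inj₂ y))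
    inOcc : ∀ t {x y} → SupportAdj _ x y → ClauseAdj j (inj₂ (t , x)) (inj₂ (t , y))
    C–Occ : ∀ t → ClauseAdj j (inj₁ (inj₁ (inj₁ tt))) (inj₂ (t , inj₁ tt))
    Occ–C : ∀ t → ClauseAdj j (inj₂ (t , inj₁ tt)) (inj₁ (inj₁ (inj₁ tt)))
    D–C   : ClauseAdj j (inj₁ (inj₂ (inj₁ tt))) (inj₁ (inj₁ (inj₁ tt)))
    C–D   : ClauseAdj j (inj₁ (inj₁ (inj₁ tt))) (inj₁ (inj₂ (inj₁ tt)))

  -- The labelling with c_j labelled cL (5 during the construction, 0 after it).
  clauseLab : Fin 8 → ∀ j → ClauseV j → Fin 8
  clauseLab cL j = [ [ centreLab cL , centreLab (# 6) ] ,
                     uncurry (λ t → centreLab (polarityLab (polarity j t))) ]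

  data ClausePort (cL : Fin 8) (j : Fin m) : ClauseV j → Fin 8 → Set where
    cPort    : ClausePort cL j (inj₁ (inj₁ (inj₁ tt))) cL
    dPort    : ClausePort cL j (inj₁ (inj₂ (inj₁ tt))) (# 6)
    positive : ∀ t → polarity j t ≡ true  → ClausePort cL j (inj₂ (t , inj₁ tt)) (# 3)
    negative : ∀ t → polarity j t ≡ false → ClausePort cL j (inj₂ (t , inj₁ tt)) (# 4)

  occurrencePort : ∀ cL j t → ClausePort cL j (inj₂ (t , inj₁ tt)) (polarityLab (polarity j t))
  occurrencePort cL j t with polarity j t in eq
  ... | true  = positive t eq
  ... | false = negative t eq

  clausePort : ∀ cL j z {ℓ} → clauseLab cL j z ≡ ℓ → ℓ ≢ # 0 → ClausePort cL j z ℓ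
  clausePort cL j (inj₁ (inj₁ x)) e ℓ≢0 with centrePort x e ℓ≢0
  ... | isCentre = cPort
  clausePort cL j (inj₁ (inj₂ x)) e ℓ≢0 with centrePort x e ℓ≢0
  ... | isCentre = dPort
  clausePort cL j (inj₂ (t , x)) e ℓ≢0 with centrePort x e ℓ≢0
  ... | isCentre = occurrencePort cL j t

  ClauseJoined : ∀ j → ClauseV j → ClauseV j → Set
  ClauseJoined j = JoinAdj L (# 6) (# 5) (JoinAdj L (# 5) (# 4) (JoinAdj L (# 5) (# 3)
                     (UnionAdj (UnionAdj (SupportAdj _) (SupportAdj _))
                               (FamilyAdj (λ t → SupportAdj _)))))
    where
    L : ClauseV j → Fin 8
    L = clauseLab (# 5) j

  clause⇒joined : ∀ j x y → ClauseAdj j x y → ClauseJoined j x y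
  clause⇒joined j _ _ (inC p)     = inj₁ (inj₁ (inj₁ (left (left p))))
  clause⇒joined j _ _ (inD p)     = inj₁ (inj₁ (inj₁ (left (right p))))
  clause⇒joined j _ _ (inOcc t p) = inj₁ (inj₁ (inj₁ (right (inside p))))
  clause⇒joined j _ _ (C–Occ t) with polarityLab-3or4 (polarity j t)
  ... | inj₁ is3 = inj₁ (inj₁ (inj₂ (inj₁ (refl , is3))))
  ... | inj₂ is4 = inj₁ (inj₂ (inj₁ (refl , is4)))
  clause⇒joined j _ _ (Occ–C t) with polarityLab-3or4 (polarity j t)
  ... | inj₁ is3 = inj₁ (inj₁ (inj₂ (inj₂ (is3 , refl))))
  ... | inj₂ is4 = inj₁ (inj₂ (inj₂ (is4 , refl)))
  clause⇒joined j _ _ D–C         = inj₂ (inj₁ (refl , refl))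
  clause⇒joined j _ _ C–D         = inj₂ (inj₂ (refl , refl))

  joined⇒clause : ∀ j x y → ClauseJoined j x y → ClauseAdj j x y
  joined⇒clause j _ _ (inj₁ (inj₁ (inj₁ (left (left p)))))    = inC p
  joined⇒clause j _ _ (inj₁ (inj₁ (inj₁ (left (right p)))))   = inD p
  joined⇒clause j _ _ (inj₁ (inj₁ (inj₁ (right (inside p))))) = inOcc _ p
  joined⇒clause j x y (inj₁ (inj₁ (inj₂ (inj₁ (x5 , y3))))) 
      with clausePort (# 5) j x x5 (λ ()) | clausePort (# 5) j y y3 (λ ())
  ... | cPort | positive t _ = C–Occ t
  joined⇒clause j x y (inj₁ (inj₁ (inj₂ (inj₂ (x3 , y5))))) 
      with clausePort (# 5) j x x3 (λ ()) | clausePort (# 5) j y y5 (λ ())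
  ... | positive t _ | cPort = Occ–C t
  joined⇒clause j x y (inj₁ (inj₂ (inj₁ (x5 , y4)))) 
      with clausePort (# 5) j x x5 (λ ()) | clausePort (# 5) j y y4 (λ ())
  ... | cPort | negative t _ = C–Occ t
  joined⇒clause j x y (inj₁ (inj₂ (inj₂ (x4 , y5)))) 
      with clausePort (# 5) j x x4 (λ ()) | clausePort (# 5) j y y5 (λ ())
  ... | negative t _ | cPort = Occ–C t
  joined⇒clause j x y (inj₂ (inj₁ (x6 , y5))) 
      with clausePort (# 5) j x x6 (λ ()) | clausePort (# 5) j y y5 (λ ())
  ... | dPort | cPort = D–C
  joined⇒clause j x y (inj₂ (inj₂ (x5 , y6))) 
      with clausePort (# 5) j x x5 (λ ()) | clausePort (# 5) j y y6 (λ ())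
  ... | cPort | dPort = C–D

  retire-c : ∀ j x → relabelled (# 5) (# 0) (clauseLab (# 5) j x) ≡ clauseLab (# 0) j x
  retire-c j (inj₁ (inj₁ (inj₁ tt))) = refl
  retire-c j (inj₁ (inj₁ (inj₂ _)))  = refl
  retire-c j (inj₁ (inj₂ (inj₁ tt))) = refl
  retire-c j (inj₁ (inj₂ (inj₂ _)))  = refl
  retire-c j (inj₂ (t , inj₁ tt)) with polarity j t
  ... | true  = refl
  ... | false = refl
  retire-c j (inj₂ (t , inj₂ _))     = refl

  clause-gadget : ∀ j → Realisation (ClauseV j) (clauseLab (# 0) j) (ClauseAdj j)
  clause-gadget j = adjust (retire-c j) (clause⇒joined j) (joined⇒clause j)
    (relabel' (# 5) (# 0) (join' (# 6) (# 5) (λ ()) (join' (# 5) (# 4) (λ ()) (join' (# 5) (# 3) (λ ())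
      (unionFin 3 (union (gadget (c j) (# 5)) (gadget (d j) (# 6)))
                  (λ t → gadget (xo j t) (polarityLab (polarity j t))))))))

  Top : Set
  Top = (Gadget u ⊎ Σ (Fin n) VarV) ⊎ Σ (Fin m) ClauseV

  topLab : Top → Fin 8
  topLab = [ [ centreLab (# 7) , uncurry varLab ] , uncurry (clauseLab (# 0)) ]

  UnitedAdj : Top → Top → Set
  UnitedAdj = UnionAdj (UnionAdj (SupportAdj _) (FamilyAdj VarAdj)) (FamilyAdj ClauseAdj)

  TopAdj : Top → Top → Set
  TopAdj = JoinAdj topLab (# 7) (# 6) (JoinAdj topLab (# 4) (# 2)
             (JoinAdj topLab (# 3) (# 1) UnitedAdj))

  assembled : Realisation Top topLab TopAdj
  assembled = join' (# 7) (# 6) (λ ()) (join' (# 4) (# 2) (λ ()) (join' (# 3) (# 1) (λ ())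
    (unionFin m (unionFin n (gadget u (# 7)) variable-gadget) clause-gadget)))

  data TopPort : Top → Fin 8 → Set where
    uPort   : TopPort (inj₁ (inj₁ (inj₁ tt))) (# 7)
    xPPort  : ∀ i → TopPort (inj₁ (inj₂ (i , inj₁ (inj₁ tt)))) (# 1)
    xNPort  : ∀ i → TopPort (inj₁ (inj₂ (i , inj₂ (inj₁ tt)))) (# 2)
    dPort   : ∀ j → TopPort (inj₂ (j , inj₁ (inj₂ (inj₁ tt)))) (# 6)
    posPort : ∀ j t → polarity j t ≡ true  → TopPort (inj₂ (j , inj₂ (t , inj₁ tt))) (# 3)
    negPort : ∀ j t → polarity j t ≡ false → TopPort (inj₂ (j , inj₂ (t , inj₁ tt))) (# 4)

  topPort : ∀ z {ℓ} → topLab z ≡ ℓ → ℓ ≢ # 0 → TopPort z ℓ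
  topPort (inj₁ (inj₁ x)) e ℓ≢0 with centrePort x e ℓ≢0
  ... | isCentre = uPort
  topPort (inj₁ (inj₂ (i , x))) e ℓ≢0 with varPort i x e ℓ≢0
  ... | pos = xPPort i
  ... | neg = xNPort i
  topPort (inj₂ (j , x)) e ℓ≢0 with clausePort (# 0) j x e ℓ≢0
  ... | cPort          = ⊥-elim (ℓ≢0 refl)
  ... | dPort          = dPort j
  ... | positive t pol = posPort j t pol
  ... | negative t pol = negPort j t pol

  place : ∀ b → Gadget b → Top
  place (xP i)   x = inj₁ (inj₂ (i , inj₁ x))
  place (xN i)   x = inj₁ (inj₂ (i , inj₂ x))
  place (xo j t) x = inj₂ (j , inj₂ (t , x))
  place (c j)    x = inj₂ (j , inj₁ (inj₁ x))
  place (d j)    x = inj₂ (j , inj₁ (inj₂ x))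
  place u        x = inj₁ (inj₁ x)

  unGadget : ∀ b → Gadget b → Vtx φ
  unGadget b (inj₁ tt)          = base b
  unGadget b (inj₂ (s , p , r)) = cl b s p r

  toTop : Vtx φ → Top
  toTop (base b)     = place b (inj₁ tt)
  toTop (cl b s p r) = place b (inj₂ (s , p , r))

  fromTop : Top → Vtx φ
  fromTop (inj₁ (inj₁ x))            = unGadget u x
  fromTop (inj₁ (inj₂ (i , inj₁ x))) = unGadget (xP i) x
  fromTop (inj₁ (inj₂ (i , inj₂ x))) = unGadget (xN i) x
  fromTop (inj₂ (j , inj₁ (inj₁ x))) = unGadget (c j) x
  fromTop (inj₂ (j , inj₁ (inj₂ x))) = unGadget (d j) x
  fromTop (inj₂ (j , inj₂ (t , x)))  = unGadget (xo j t) x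

  fromTop-place : ∀ b x → fromTop (place b x) ≡ unGadget b x
  fromTop-place (xP i)   x = refl
  fromTop-place (xN i)   x = refl
  fromTop-place (xo j t) x = refl
  fromTop-place (c j)    x = refl
  fromTop-place (d j)    x = refl
  fromTop-place u        x = refl

  toTop-unGadget : ∀ b x → toTop (unGadget b x) ≡ place b x
  toTop-unGadget b (inj₁ tt) = refl
  toTop-unGadget b (inj₂ _)  = refl

  fromTop-toTop : ∀ v → fromTop (toTop v) ≡ v
  fromTop-toTop (base b)     = fromTop-place b (inj₁ tt)
  fromTop-toTop (cl b s p r) = fromTop-place b (inj₂ (s , p , r))

  toTop-fromTop : ∀ z → toTop (fromTop z) ≡ z
  toTop-fromTop (inj₁ (inj₁ x))            = toTop-unGadget u x
  toTop-fromTop (inj₁ (inj₂ (i , inj₁ x))) = toTop-unGadget (xP i) x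
  toTop-fromTop (inj₁ (inj₂ (i , inj₂ x))) = toTop-unGadget (xN i) x
  toTop-fromTop (inj₂ (j , inj₁ (inj₁ x))) = toTop-unGadget (c j) x
  toTop-fromTop (inj₂ (j , inj₁ (inj₂ x))) = toTop-unGadget (d j) x
  toTop-fromTop (inj₂ (j , inj₂ (t , x)))  = toTop-unGadget (xo j t) x

  within : ∀ b {x y} → SupportAdj (support φ b) x y → TopAdj (place b x) (place b y)
  within (xP i)   p = inj₁ (inj₁ (inj₁ (left (right (inside (inP p))))))
  within (xN i)   p = inj₁ (inj₁ (inj₁ (left (right (inside (inN p))))))
  within (xo j t) p = inj₁ (inj₁ (inj₁ (right (inside (inOcc t p)))))
  within (c j)    p = inj₁ (inj₁ (inj₁ (right (inside (inC p)))))
  within (d j)    p = inj₁ (inj₁ (inj₁ (right (inside (inD p)))))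
  within u        p = inj₁ (inj₁ (inj₁ (left (left p))))

  united : ∀ {z w} → UnitedAdj z w → TopAdj z w
  united p = inj₁ (inj₁ (inj₁ p))

  edge→ : ∀ {x y} → Edge φ x y → TopAdj (toTop x) (toTop y)
  edge→ (eX i)                = united (left (right (inside P–N)))
  edge→ (eOccP j t i' pol)    = inj₁ (inj₁ (inj₂ (inj₁ (cong polarityLab pol , refl))))
  edge→ (eOccN j t i' pol)    = inj₁ (inj₂ (inj₁ (cong polarityLab pol , refl)))
  edge→ (eC j t)              = united (right (inside (C–Occ t)))
  edge→ (eD j)                = united (right (inside D–C))
  edge→ (eU j)                = inj₂ (inj₁ (refl , refl))
  edge→ (eCl b s p r r' r≢r') = within b (inClique s p r r' r≢r')
  edge→ (eAtt b s p)          = within b (attach' s p)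

  edge← : ∀ {x y} → Edge φ x y → TopAdj (toTop y) (toTop x)
  edge← (eX i)                = united (left (right (inside N–P)))
  edge← (eOccP j t i' pol)    = inj₁ (inj₁ (inj₂ (inj₂ (refl , cong polarityLab pol))))
  edge← (eOccN j t i' pol)    = inj₁ (inj₂ (inj₂ (refl , cong polarityLab pol)))
  edge← (eC j t)              = united (right (inside (Occ–C t)))
  edge← (eD j)                = united (right (inside C–D))
  edge← (eU j)                = inj₂ (inj₂ (refl , refl))
  edge← (eCl b s p r r' r≢r') = within b (inClique s p r' r (λ r'≡r → r≢r' (sym r'≡r)))
  edge← (eAtt b s p)          = within b (attach s p)

  adj→ : ∀ x y → Adj φ x y → TopAdj (toTop x) (toTop y)
  adj→ x y (inj₁ e) = edge→ e
  adj→ x y (inj₂ e) = edge← e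

  gadget-adj : ∀ b {x y} → SupportAdj (support φ b) x y → Adj φ (unGadget b x) (unGadget b y)
  gadget-adj b (attach s p)             = inj₂ (eAtt b s p)
  gadget-adj b (attach' s p)            = inj₁ (eAtt b s p)
  gadget-adj b (inClique s p r r' r≢r') = inj₁ (eCl b s p r r' r≢r')

  united-adj : ∀ z w → UnitedAdj z w → Adj φ (fromTop z) (fromTop w)
  united-adj _ _ (left (left p))                     = gadget-adj u p
  united-adj _ _ (left (right (inside {i} (inP p)))) = gadget-adj (xP i) p
  united-adj _ _ (left (right (inside {i} (inN p)))) = gadget-adj (xN i) p
  united-adj _ _ (left (right (inside {i} P–N)))     = inj₁ (eX i)
  united-adj _ _ (left (right (inside {i} N–P)))     = inj₂ (eX i)
  united-adj _ _ (right (inside {j} (inC p)))        = gadget-adj (c j) p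
  united-adj _ _ (right (inside {j} (inD p)))        = gadget-adj (d j) p
  united-adj _ _ (right (inside {j} (inOcc t p)))    = gadget-adj (xo j t) p
  united-adj _ _ (right (inside {j} (C–Occ t)))      = inj₁ (eC j t)
  united-adj _ _ (right (inside {j} (Occ–C t)))      = inj₂ (eC j t)
  united-adj _ _ (right (inside {j} D–C))            = inj₁ (eD j)
  united-adj _ _ (right (inside {j} C–D))            = inj₂ (eD j)

  top-adj : ∀ z w → TopAdj z w → Adj φ (fromTop z) (fromTop w)
  top-adj z w (inj₁ (inj₁ (inj₁ p))) = united-adj z w p
  top-adj z w (inj₁ (inj₁ (inj₂ (inj₁ (z3 , w1))))) with topPort z z3 (λ ()) | topPort w w1 (λ ())
  ... | posPort j t pol | xPPort i = inj₁ (eOccP j t i pol)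
  top-adj z w (inj₁ (inj₁ (inj₂ (inj₂ (z1 , w3))))) with topPort z z1 (λ ()) | topPort w w3 (λ ())
  ... | xPPort i | posPort j t pol = inj₂ (eOccP j t i pol)
  top-adj z w (inj₁ (inj₂ (inj₁ (z4 , w2)))) with topPort z z4 (λ ()) | topPort w w2 (λ ())
  ... | negPort j t pol | xNPort i = inj₁ (eOccN j t i pol)
  top-adj z w (inj₁ (inj₂ (inj₂ (z2 , w4)))) with topPort z z2 (λ ()) | topPort w w4 (λ ())
  ... | xNPort i | negPort j t pol = inj₂ (eOccN j t i pol)
  top-adj z w (inj₂ (inj₁ (z7 , w6))) with topPort z z7 (λ ()) | topPort w w6 (λ ())
  ... | uPort | dPort j = inj₁ (eU j)
  top-adj z w (inj₂ (inj₂ (z6 , w7))) with topPort z z6 (λ ()) | topPort w w7 (λ ())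
  ... | dPort j | uPort = inj₂ (eU j)

  realisation : Realisation (Vtx φ) (topLab ∘′ toTop) (Adj φ)
  realisation =
    transport toTop fromTop fromTop-toTop toTop-fromTop (λ _ → refl) adj→ top-adj assembled

lemma5p4 : (n m : ℕ) (φ : CNF3 n m) → CwAtMost 8 (Vtx φ) (Adj φ)
lemma5p4 n m φ = realisation⇒cw (Construction.realisation φ)
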